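{- Let $T_1$ and $T_2$ be trees, and consider the game of Cops and Robbers played on the Cartesian product $T_1 \square T_2$ with a single cop. The cop has a strategy (including the choice of his starting vertex) such that, in any play of the game in which the robber moves (i.e. changes his position) at least $\mathrm{rad}(T_1 \square T_2)$ times, the cop captures the robber, and does so immediately after the robber's last move.
   Context: Cops and Robbers is played on a finite reflexive graph (every vertex carries a loop, so a player may pass). The cops first choose starting vertices, then the robber chooses a starting vertex; afterwards players alternate, the cops moving first: each cop moves to a neighbouring vertex or stays, then the robber moves to a neighbouring vertex or stays. The cops capture the robber when some cop occupies the same vertex as the robber. The Cartesian product $G \square H$ has vertex set $V(G)\times V(H)$, with $(u,v)$ adjacent to $(u',v')$ iff either $u=u'$ and $vv' \in E(H)$, or $v=v'$ and $uu'\in E(G)$. The eccentricity of a vertex is its maximum distance to another vertex; the radius $\mathrm{rad}(G)$ is the minimum eccentricity of a vertex of $G$. -}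

module Defs where

open import Data.Nat using (ℕ; zero; suc; _≤_; _<_)
open import Data.Fin using (Fin)
open import Data.Product using (Σ; ∃-syntax; _×_; _,_)
open import Data.Sum using (_⊎_)
open import Relation.Nullary using (¬_)
open import Relation.Binary.PropositionalEquality using (_≡_; _≢_)
open import Data.List using (List; []; _∷_; _++_; map; upTo)
open import Data.List.Relation.Unary.Unique.Propositional using (Unique)
open import Data.List.Relation.Unary.Linked using (Linked)

record Graph : Set₁ where
  field
    n      : ℕ
    Adj    : Fin n → Fin n → Set
    sym    : ∀ {u v} → Adj u v → Adj v u
    irrefl : ∀ {u} → ¬ Adj u u

open Graph public

data Walk {V : Set} (A : V → V → Set) : V → V → ℕ → Set where
  here : ∀ {u} → Walk A u u 0
  step : ∀ {u v w k} → A u v → Walk A v w k → Walk A u w (suc k)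

DistLe : {V : Set} → (V → V → Set) → V → V → ℕ → Set
DistLe A u v k = ∃[ j ] (j ≤ k × Walk A u v j)

Connected : {V : Set} → (V → V → Set) → Set
Connected {V} A = (u v : V) → ∃[ k ] Walk A u v k

HasCycle : {V : Set} → (V → V → Set) → Set
HasCycle {V} A =
  Σ V λ a → Σ V λ b → Σ V λ c → Σ (List V) λ rest →
    Unique (a ∷ b ∷ c ∷ rest) × Linked A ((a ∷ b ∷ c ∷ rest) ++ (a ∷ []))

IsTree : Graph → Set
IsTree G = (1 ≤ n G) × Connected (Adj G) × ¬ HasCycle (Adj G)

EccLe : {V : Set} → (V → V → Set) → V → ℕ → Set
EccLe {V} A v k = (w : V) → DistLe A v w k

IsRadius : {V : Set} → (V → V → Set) → ℕ → Set
IsRadius {V} A ρ =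
  (∃[ v ] EccLe A v ρ) × ((k : ℕ) → ∃[ v ] EccLe A v k → ρ ≤ k)

ProdV : Graph → Graph → Set
ProdV G H = Fin (n G) × Fin (n H)

ProdAdj : (G H : Graph) → ProdV G H → ProdV G H → Set
ProdAdj G H (u , v) (u' , v') =
  (u ≡ u' × Adj H v v') ⊎ (v ≡ v' × Adj G u u')

Move : {V : Set} → (V → V → Set) → V → V → Set
Move A u v = (u ≡ v) ⊎ A u v

-- Robber positions: r 0 is the robber's starting vertex, r (suc t) his
-- position after his (t+1)-th turn.
RobberLegal : {V : Set} → (V → V → Set) → (ℕ → V) → Set
RobberLegal A r = (t : ℕ) → Move A (r t) (r (suc t))

-- A (deterministic) cop strategy: a starting vertex, and a rule giving the
-- cop's next vertex from the robber's positions r 0, ..., r t so far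
-- (the cop's own past positions are determined by these).
CopStrategy : Set → Set
CopStrategy V = V × (List V → V)

prefix : {V : Set} → (ℕ → V) → ℕ → List V
prefix r t = map r (upTo (suc t))

-- copPos σ r 0 is the cop's start; copPos σ r (suc t) is the cop's
-- position after his (t+1)-th move, made after seeing r 0 … r t.
copPos : {V : Set} → CopStrategy V → (ℕ → V) → ℕ → V
copPos (c0 , f) r zero    = c0
copPos (c0 , f) r (suc t) = f (prefix r t)

data MovesCount {V : Set} (r : ℕ → V) : ℕ → ℕ → Set where
  mc0    : MovesCount r 0 0
  mcStay : ∀ {t m} → r t ≡ r (suc t) → MovesCount r t m → MovesCount r (suc t) m
  mcMove : ∀ {t m} → r t ≢ r (suc t) → MovesCount r t m → MovesCount r (suc t) (suc m)

-- No capture has happened up to and including the robber's t-th turn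
-- (turn 0 = choice of starting vertices).
Uncaptured : {V : Set} → (ℕ → V) → (ℕ → V) → ℕ → Set
Uncaptured c r t =
  ((i : ℕ) → i ≤ t → c i ≢ r i) × ((i : ℕ) → i < t → c (suc i) ≢ r i)

-- Root both trees at the coordinates of a central vertex of T₁ □ T₂ and start the cop there.  The
-- cop keeps, in each tree, a position that is an ancestor of the robber's, k₁ and k₂ levels above
-- him.  A robber move changes k₁ + k₂ by one; the cop answers a move (k₁ + k₂ odd) by stepping
-- towards the robber in the coordinate with the larger gap and otherwise stays.  Once the cop has
-- left the root in a coordinate the gaps stay balanced there, so the robber can never climb past
-- the cop, and the cop's depth sum grows by one per robber move.  After rad moves it is at least
-- rad, hence at least the robber's depth sum, which is bounded by his distance from the centre;
-- so both gaps are zero.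
module Submission where

open import Algebra.Properties.CommutativeSemigroup using (interchange)
open import Data.Empty using (⊥-elim)
open import Data.Fin using (Fin)
open import Data.Fin.Properties using (_≟_)
open import Data.List using (List; []; _∷_; _++_; [_]; drop; length; head; map; foldl; upTo)
open import Data.List.Membership.Propositional using (_∈_)
open import Data.List.Membership.Propositional.Properties using (∈-++⁻)
open import Data.List.Properties using (∷-injectiveˡ; ∷-injectiveʳ; upTo-∷ʳ; map-++; foldl-++)
open import Data.List.Relation.Binary.Subset.Propositional using (_⊆_)
open import Data.List.Relation.Binary.Subset.Propositional.Properties using (∷⁺ʳ)
open import Data.List.Relation.Unary.All using (All; []; _∷_; lookup)
import Data.List.Relation.Unary.All.Properties as All
open import Data.List.Relation.Unary.Any using (here; there)
open import Data.List.Relation.Unary.Linked using (Linked; []; [-]; _∷_)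
open import Data.List.Relation.Unary.Unique.Propositional using (Unique; []; _∷_)
import Data.List.Relation.Unary.Unique.Propositional.Properties as Unique
open import Data.Maybe using (fromMaybe)
open import Data.Nat using (ℕ; zero; suc; _+_; _∸_; _≤_; _<_; z≤n; s≤s; parity)
open import Data.Nat.Properties
  using ( +-suc; +-identityʳ; +-commutativeSemigroup; +-monoˡ-≤; +-monoʳ-≤; +-cancelˡ-≤
        ; suc-injective; ≤-refl; ≤-reflexive; ≤-trans; ≤-pred; n≤1+n; m≤n⇒m≤1+n; n<1+n; n≮0
        ; n≤0⇒n≡0; m+n≡0⇒m≡0; m+n≡0⇒n≡0; m+n∸m≡n; ≮⇒≥; ≤∧≢⇒<; _<?_; module ≤-Reasoning )
open import Data.Parity.Base using (Parity; 0ℙ; 1ℙ; _⁻¹)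
open import Data.Parity.Properties using (⁻¹-selfInverse; suc-homo-⁻¹; +-homo-+; p+p≡0ℙ)
open import Data.Product using (Σ; ∃; ∃₂; _×_; _,_; proj₁; proj₂)
open import Data.Product.Properties using (≡-dec)
open import Data.Sum using (_⊎_; inj₁; inj₂)
open import Function using (_∘_; id)
open import Relation.Binary.Definitions using (DecidableEquality)
open import Relation.Binary.PropositionalEquality
  using (_≡_; _≢_; refl; sym; trans; cong; cong₂; subst; module ≡-Reasoning)
open import Relation.Nullary using (¬_; yes; no)

open import Defs renaming (sym to Adj-sym)

module _ {V : Set} where

  ∈⇒drop : ∀ {x : V} {xs} → x ∈ xs → ∃₂ λ j ys → drop j xs ≡ x ∷ ys
  ∈⇒drop {xs = _ ∷ ys} (here refl) = 0 , ys , refl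
  ∈⇒drop (there x∈xs) with j , ys , eq ← ∈⇒drop x∈xs = suc j , ys , eq

  drop-⊆ : ∀ j (xs : List V) → drop j xs ⊆ xs
  drop-⊆ zero    xs       = id
  drop-⊆ (suc j) []       = id
  drop-⊆ (suc j) (_ ∷ xs) = there ∘ drop-⊆ j xs

  drop-suc : ∀ k (xs : List V) {y ys} → drop (suc k) xs ≡ y ∷ ys → ∃ λ x → drop k xs ≡ x ∷ y ∷ ys
  drop-suc zero    (x ∷ xs) refl = x , refl
  drop-suc (suc k) (_ ∷ xs) eq   = drop-suc k xs eq

  length-drop : ∀ k (xs : List V) {y ys} → drop k xs ≡ y ∷ ys → suc (length ys + k) ≡ length xs
  length-drop zero    xs       {ys = ys} refl = cong suc (+-identityʳ (length ys))
  length-drop (suc k) (_ ∷ xs) {ys = ys} eq   = trans (cong suc (+-suc (length ys) k)) (cong suc (length-drop k xs eq))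

module _ {V : Set} (A : V → V → Set) where

  data WalkOn : V → V → List V → Set where
    []  : ∀ {u} → WalkOn u u []
    _∷_ : ∀ {u w v ws} → A u w → WalkOn w v ws → WalkOn u v (w ∷ ws)

  SimplePath : V → V → List V → Set
  SimplePath u v vs = WalkOn u v vs × Unique (u ∷ vs)

module _ {V : Set} {A : V → V → Set} where

  fromWalk : ∀ {u v k} → Walk A u v k → ∃ (WalkOn A u v)
  fromWalk here         = [] , []
  fromWalk (step e W) with vs , W′ ← fromWalk W = _ , e ∷ W′

  _++ᵂ_ : ∀ {u v w vs ws} → WalkOn A u v vs → WalkOn A v w ws → WalkOn A u w (vs ++ ws)
  []       ++ᵂ W₂ = W₂
  (e ∷ W₁) ++ᵂ W₂ = e ∷ (W₁ ++ᵂ W₂)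

  reverseᵂ : (∀ {x y} → A x y → A y x) → ∀ {u v vs} → WalkOn A u v vs →
             ∃ λ ws → WalkOn A v u ws × v ∷ ws ⊆ u ∷ vs
  reverseᵂ A-sym []      = [] , [] , id
  reverseᵂ A-sym (e ∷ W) with ws , W⁻¹ , sub ← reverseᵂ A-sym W =
    ws ++ [ _ ] , W⁻¹ ++ᵂ (A-sym e ∷ []) , λ x∈ → back (∈-++⁻ (_ ∷ ws) x∈)
    where
    back : ∀ {x} → x ∈ _ ∷ ws ⊎ x ∈ [ _ ] → x ∈ _ ∷ _ ∷ _
    back (inj₁ x∈) = there (sub x∈)
    back (inj₂ (here refl)) = here refl

  dropᵂ : ∀ j {u v vs x xs} → WalkOn A u v vs → drop j (u ∷ vs) ≡ x ∷ xs → WalkOn A x v xs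
  dropᵂ zero          W       refl = W
  dropᵂ (suc zero)    []      ()
  dropᵂ (suc (suc j)) []      ()
  dropᵂ (suc j)       (e ∷ W) eq   = dropᵂ j W eq

  end∈ : ∀ {u v vs} → WalkOn A u v vs → v ∈ u ∷ vs
  end∈ []      = here refl
  end∈ (e ∷ W) = there (end∈ W)

  drop-length-end : ∀ {u v vs} → WalkOn A u v vs → drop (length vs) (u ∷ vs) ≡ [ v ]
  drop-length-end []      = refl
  drop-length-end (e ∷ W) = drop-length-end W

  first-edge : ∀ {u v w ws} → WalkOn A u v (w ∷ ws) → A u w
  first-edge (e ∷ _) = e

  closing-linked : ∀ {u v w vs} → WalkOn A u v vs → A v w → Linked A (u ∷ vs ++ [ w ])
  closing-linked []      e′ = e′ ∷ [-]
  closing-linked (e ∷ W) e′ = e ∷ closing-linked W e′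

  dropˢ : ∀ j {u v vs x xs} → SimplePath A u v vs → drop j (u ∷ vs) ≡ x ∷ xs → SimplePath A x v xs
  dropˢ j (W , uniq) eq = dropᵂ j W eq , subst Unique eq (Unique.drop⁺ j uniq)

  module _ (_≟_ : DecidableEquality V) where
    open import Data.List.Membership.DecPropositional _≟_ using (_∈?_)

    loopErase : ∀ {u v vs} → WalkOn A u v vs → ∃ λ ws → SimplePath A u v ws × u ∷ ws ⊆ u ∷ vs
    loopErase [] = [] , ([] , [] ∷ []) , id
    loopErase {u} (_∷_ {w = w} e W)
      with ws , (W′ , uniq) , sub ← loopErase W | u ∈? (w ∷ ws)
    ... | yes u∈ with j , xs , eq ← ∈⇒drop u∈ =
      xs , dropˢ j (W′ , uniq) eq ,
      there ∘ sub ∘ drop-⊆ j (w ∷ ws) ∘ subst (_ ∈_) (sym eq)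
    ... | no u∉ = w ∷ ws , (e ∷ W′ , All.¬Any⇒All¬ _ u∉ ∷ uniq) , ∷⁺ʳ u sub

module _ {V : Set} {A : V → V → Set} (f : V → ℕ) (f-step : ∀ {u w} → A u w → f w ≤ suc (f u)) where

  walk-potential : ∀ {u v j} → Walk A u v j → f v ≤ f u + j
  walk-potential {u} here = ≤-reflexive (sym (+-identityʳ (f u)))
  walk-potential {u} (step {k = j} e W) =
    ≤-trans (walk-potential W) (≤-trans (+-monoˡ-≤ j (f-step e)) (≤-reflexive (sym (+-suc (f u) j))))

data OneApart : ℕ → ℕ → Set where
  incr : ∀ {k} → OneApart k (suc k)
  decr : ∀ {k} → OneApart (suc k) k

OneApart-sym : ∀ {k k′} → OneApart k k′ → OneApart k′ k
OneApart-sym incr = decr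
OneApart-sym decr = incr

OneApart-≤ : ∀ {k k′} → OneApart k k′ → k′ ≤ suc k
OneApart-≤ incr = ≤-refl
OneApart-≤ decr = ≤-trans (n≤1+n _) (n≤1+n _)

OneApart-≥ : ∀ {k k′} → OneApart k k′ → k ≤ suc k′
OneApart-≥ = OneApart-≤ ∘ OneApart-sym

OneApart-+ˡ : ∀ j {k k′} → OneApart k k′ → OneApart (j + k) (j + k′)
OneApart-+ˡ j {k} incr = subst (OneApart (j + k)) (sym (+-suc j k)) incr
OneApart-+ˡ j {k′ = k} decr = subst (λ x → OneApart x (j + k)) (sym (+-suc j k)) decr

OneApart-+ʳ : ∀ j {k k′} → OneApart k k′ → OneApart (k + j) (k′ + j)
OneApart-+ʳ j incr = incr
OneApart-+ʳ j decr = decr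

parity-suc : ∀ n → parity (suc n) ≡ parity n ⁻¹
parity-suc n = sym (⁻¹-selfInverse (suc-homo-⁻¹ n))

OneApart-parity : ∀ {k k′} → OneApart k k′ → parity k′ ≡ parity k ⁻¹
OneApart-parity {k}      incr = parity-suc k
OneApart-parity {k′ = k} decr = sym (⁻¹-selfInverse (sym (parity-suc k)))

odd⇒≢ : ∀ {k₁ k₂} → parity (k₁ + k₂) ≡ 1ℙ → k₁ ≢ k₂
odd⇒≢ {k} odd refl with () ← trans (sym odd) (trans (+-homo-+ k k) (p+p≡0ℙ (parity k)))

-- Trees rooted at a vertex

module Tree (G : Graph) (connected : Connected (Adj G)) (acyclic : ¬ HasCycle (Adj G)) where
  open import Data.List.Membership.DecPropositional (_≟_ {n G}) using (_∈?_)

  private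
    V = Fin (n G)
    A = Adj G

  branching⇒cycle : ∀ {u v x y p q} → x ≢ y → A u x → A u y → WalkOn A x v p → WalkOn A y v q →
                    All (u ≢_) (x ∷ p) → All (u ≢_) (y ∷ q) → HasCycle A
  branching⇒cycle {u} x≢y ux uy P Q u∉p u∉q
    with rs , Q⁻¹ , Q⁻¹⊆ ← reverseᵂ (Adj-sym G) Q
    with loopErase _≟_ (P ++ᵂ Q⁻¹)
  ... | [] , ([] , _) , _ = ⊥-elim (x≢y refl)
  ... | l ∷ es , (E , uniq) , E⊆ =
    u , _ , l , es , (All.anti-mono E⊆ u∉walk ∷ uniq) , closing-linked (ux ∷ E) (Adj-sym G uy)
    where
    u∉walk : All (u ≢_) (_ ∷ _ ++ rs)
    u∉walk = All.++⁺ u∉p (All.anti-mono (Q⁻¹⊆ ∘ there) u∉q)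

  simplePath-unique : ∀ {u v p q} → SimplePath A u v p → SimplePath A u v q → p ≡ q
  simplePath-unique ([] , _)      ([] , _)          = refl
  simplePath-unique ([] , _)      (_ ∷ Q , u∉q ∷ _) = ⊥-elim (lookup u∉q (end∈ Q) refl)
  simplePath-unique (_ ∷ P , u∉p ∷ _) ([] , _)      = ⊥-elim (lookup u∉p (end∈ P) refl)
  simplePath-unique (_∷_ {w = x} ux P , u∉p ∷ uniqP) (_∷_ {w = y} uy Q , u∉q ∷ uniqQ) with x ≟ y
  ... | yes refl = cong (x ∷_) (simplePath-unique (P , uniqP) (Q , uniqQ))
  ... | no x≢y   = ⊥-elim (acyclic (branching⇒cycle x≢y ux uy P Q u∉p u∉q))

  module Rooted (root : V) where

    geodesic : ∀ v → ∃ λ vs → SimplePath A v root vs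
    geodesic v = let (_ , P , _) = loopErase _≟_ (proj₂ (fromWalk (proj₂ (connected v root)))) in _ , P

    ancestors lineage : V → List V
    ancestors v = proj₁ (geodesic v)
    lineage   v = v ∷ ancestors v

    depth : V → ℕ
    depth v = length (ancestors v)

    lineage-unique : ∀ {v vs} → SimplePath A v root vs → lineage v ≡ v ∷ vs
    lineage-unique P = cong (_ ∷_) (simplePath-unique (proj₂ (geodesic _)) P)

    lineage-suffix : ∀ j b {x xs} → drop j (lineage b) ≡ x ∷ xs → lineage x ≡ x ∷ xs
    lineage-suffix j b eq = lineage-unique (dropˢ j (proj₂ (geodesic b)) eq)

    lineage-root : lineage root ≡ [ root ]
    lineage-root = lineage-unique ([] , [] ∷ [])

    depth-root : depth root ≡ 0
    depth-root = suc-injective (cong length lineage-root)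

    Parent : V → V → Set
    Parent p c = lineage c ≡ c ∷ lineage p

    Parent⇒Adj : ∀ {p c} → Parent p c → A p c
    Parent⇒Adj {c = c} eq =
      Adj-sym G (first-edge (subst (WalkOn A c root) (∷-injectiveʳ eq) (proj₁ (proj₂ (geodesic c)))))

    Parent⇒depth : ∀ {p c} → Parent p c → depth c ≡ suc (depth p)
    Parent⇒depth eq = suc-injective (cong length eq)

    adjacent⇒parent : ∀ {b b′} → A b b′ → Parent b b′ ⊎ Parent b′ b
    adjacent⇒parent {b} {b′} e with proj₂ (geodesic b) | b′ ∈? ancestors b
    ... | (W , b∉ ∷ uniq) | yes b′∈ with j , S , eq ← ∈⇒drop b′∈ =
      inj₂ (trans (lineage-unique (e ∷ proj₁ P , subst (All (b ≢_)) eq (All.drop⁺ j b∉) ∷ proj₂ P))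
                  (cong (b ∷_) (sym (lineage-unique P))))
      where P = dropˢ (suc j) (W , b∉ ∷ uniq) eq
    ... | (W , uniq) | no b′∉ =
      inj₁ (lineage-unique (Adj-sym G e ∷ W , (b′≢b ∷ All.¬Any⇒All¬ _ b′∉) ∷ uniq))
      where
      b′≢b : b′ ≢ b
      b′≢b refl = irrefl G e

    depth-adjacent : ∀ {u w} → A u w → depth w ≤ suc (depth u)
    depth-adjacent e with adjacent⇒parent e
    ... | inj₁ par = ≤-reflexive (Parent⇒depth par)
    ... | inj₂ par = m≤n⇒m≤1+n (subst (_ ≤_) (sym (Parent⇒depth par)) (n≤1+n _))

    record Ancestor (k : ℕ) (a b : V) : Set where
      constructor ancestor
      field drop-lineage : drop k (lineage b) ≡ lineage a

    Ancestor-depth : ∀ {k a b} → Ancestor k a b → depth a + k ≡ depth b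
    Ancestor-depth {k} {b = b} (ancestor eq) = suc-injective (length-drop k (lineage b) eq)

    Ancestor-zero : ∀ {a b} → Ancestor 0 a b → a ≡ b
    Ancestor-zero (ancestor eq) = sym (∷-injectiveˡ eq)

    root-Ancestor : ∀ b → Ancestor (depth b) root b
    root-Ancestor b = ancestor (trans (drop-length-end (proj₁ (proj₂ (geodesic b)))) (sym lineage-root))

    Ancestor-child : ∀ {k a b c} → Ancestor k a b → Parent b c → Ancestor (suc k) a c
    Ancestor-child {k} (ancestor eq) par = ancestor (trans (cong (drop (suc k)) par) eq)

    Ancestor-parent : ∀ {k a b p} → Ancestor (suc k) a b → Parent p b → Ancestor k a p
    Ancestor-parent {k} (ancestor eq) par = ancestor (trans (cong (drop (suc k)) (sym par)) eq)

    Ancestor-towards : ∀ {k a b} → Ancestor (suc k) a b → ∃ λ x → Parent a x × Ancestor k x b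
    Ancestor-towards {k} {b = b} (ancestor eq) with x , eq′ ← drop-suc k (lineage b) eq =
      x , lineage-suffix k b eq′ , ancestor (trans eq′ (sym (lineage-suffix k b eq′)))

    Ancestor-adjacent : ∀ {k a b b′} → Ancestor k a b → A b b′ →
                        (∃ λ k′ → Ancestor k′ a b′ × OneApart k k′) ⊎ (k ≡ 0 × 0 < depth a)
    Ancestor-adjacent anc e with adjacent⇒parent e
    Ancestor-adjacent {k}     anc e | inj₁ par = inj₁ (suc k , Ancestor-child anc par , incr)
    Ancestor-adjacent {suc k} anc e | inj₂ par = inj₁ (k , Ancestor-parent anc par , decr)
    Ancestor-adjacent {zero}  anc e | inj₂ par with refl ← Ancestor-zero anc
      rewrite Parent⇒depth par = inj₂ (refl , s≤s z≤n)

    ancestorAt : ℕ → V → V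
    ancestorAt k b = fromMaybe b (head (drop k (lineage b)))

    ancestorAt-Ancestor : ∀ {k a b} → Ancestor k a b → ancestorAt k b ≡ a
    ancestorAt-Ancestor {b = b} (ancestor eq) = cong (fromMaybe b ∘ head) eq

module _ {V : Set} where

  positional : V → (V → V → V) → CopStrategy V
  positional c₀ next = c₀ , foldl next c₀

  copPos-positional : ∀ {c₀ next} (r : ℕ → V) t →
                      copPos (positional c₀ next) r (suc t) ≡ next (copPos (positional c₀ next) r t) (r t)
  copPos-positional {c₀} {next} r t = begin
    foldl next c₀ (map r (upTo (suc t)))         ≡⟨ cong (foldl next c₀ ∘ map r) (sym (upTo-∷ʳ t)) ⟩
    foldl next c₀ (map r (upTo t ++ [ t ]))      ≡⟨ cong (foldl next c₀) (map-++ r (upTo t) [ t ]) ⟩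
    foldl next c₀ (map r (upTo t) ++ [ r t ])    ≡⟨ foldl-++ next c₀ (map r (upTo t)) [ r t ] ⟩
    next (foldl next c₀ (map r (upTo t))) (r t)  ≡⟨ cong (λ c → next c (r t)) (folded t) ⟩
    next (copPos (positional c₀ next) r t) (r t) ∎
    where
    open ≡-Reasoning
    folded : ∀ t → foldl next c₀ (map r (upTo t)) ≡ copPos (positional c₀ next) r t
    folded zero    = refl
    folded (suc t) = refl

  movesCount : DecidableEquality V → ∀ (r : ℕ → V) t → ∃ (MovesCount r t)
  movesCount _≟_ r zero = 0 , mc0
  movesCount _≟_ r (suc t) with m , mc ← movesCount _≟_ r t | r t ≟ r (suc t)
  ... | yes stay = m , mcStay stay mc
  ... | no move  = suc m , mcMove move mc

  Uncaptured-pred : ∀ {c r : ℕ → V} {t} → Uncaptured c r (suc t) → Uncaptured c r t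
  Uncaptured-pred (apart , apart′) =
    (λ i i≤t → apart i (m≤n⇒m≤1+n i≤t)) , (λ i i<t → apart′ i (m≤n⇒m≤1+n i<t))

-- The cop's strategy on T₁ □ T₂

module Pursuit (T₁ T₂ : Graph)
  (connected₁ : Connected (Adj T₁)) (acyclic₁ : ¬ HasCycle (Adj T₁)) (root₁ : Fin (n T₁))
  (connected₂ : Connected (Adj T₂)) (acyclic₂ : ¬ HasCycle (Adj T₂)) (root₂ : Fin (n T₂)) where

  module R₁ = Tree.Rooted T₁ connected₁ acyclic₁ root₁
  module R₂ = Tree.Rooted T₂ connected₂ acyclic₂ root₂

  private
    V = ProdV T₁ T₂
    _⇿_ = ProdAdj T₁ T₂

  level : V → ℕ
  level (x , y) = R₁.depth x + R₂.depth y

  level-step : ∀ {u w} → u ⇿ w → level w ≤ suc (level u)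
  level-step {x , _} (inj₁ (refl , e)) =
    ≤-trans (+-monoʳ-≤ (R₁.depth x) (R₂.depth-adjacent e)) (≤-reflexive (+-suc _ _))
  level-step {_ , y} (inj₂ (refl , e)) = +-monoˡ-≤ (R₂.depth y) (R₁.depth-adjacent e)

  level-bound : ∀ {ρ} → EccLe _⇿_ (root₁ , root₂) ρ → ∀ b → level b ≤ ρ
  level-bound {ρ} ecc b with j , j≤ρ , W ← ecc b =
    ≤-trans (walk-potential level level-step W)
            (subst (λ l → l + j ≤ ρ) (sym (cong₂ _+_ R₁.depth-root R₂.depth-root)) j≤ρ)

  lag : Parity → ℕ
  lag 0ℙ = 0
  lag 1ℙ = 1

  -- After m robber moves the cop at a is an ancestor of the robber at b in both trees, k₁ and k₂
  -- levels above him.  Index 1ℙ marks a robber move the cop has not answered yet.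
  record Chasing (p : Parity) (m : ℕ) (a b : V) : Set where
    constructor chasing
    field
      k₁ k₂       : ℕ
      anc₁        : R₁.Ancestor k₁ (proj₁ a) (proj₁ b)
      anc₂        : R₂.Ancestor k₂ (proj₂ a) (proj₂ b)
      lead₁       : 0 < R₁.depth (proj₁ a) → k₂ ≤ lag p + k₁
      lead₂       : 0 < R₂.depth (proj₂ a) → k₁ ≤ lag p + k₂
      gaps-parity : parity (k₁ + k₂) ≡ p
      progress    : m ≤ lag p + level a

  pursue : V → V → ℕ → ℕ → V
  pursue (a₁ , a₂) (b₁ , b₂) k₁ k₂ with parity (k₁ + k₂) | k₂ <? k₁
  ... | 0ℙ | _     = a₁ , a₂
  ... | 1ℙ | yes _ = R₁.ancestorAt (k₁ ∸ 1) b₁ , a₂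
  ... | 1ℙ | no _  = a₁ , R₂.ancestorAt (k₂ ∸ 1) b₂

  chase : V → V → V
  chase a b = pursue a b (R₁.depth (proj₁ b) ∸ R₁.depth (proj₁ a)) (R₂.depth (proj₂ b) ∸ R₂.depth (proj₂ a))

  chase-pursue : ∀ {p m a b} (c : Chasing p m a b) → chase a b ≡ pursue a b (Chasing.k₁ c) (Chasing.k₂ c)
  chase-pursue {a = a₁ , a₂} {b₁ , b₂} (chasing k₁ k₂ anc₁ anc₂ _ _ _ _) =
    cong₂ (pursue (a₁ , a₂) (b₁ , b₂)) (gap (R₁.Ancestor-depth anc₁)) (gap (R₂.Ancestor-depth anc₂))
    where
    gap : ∀ {d k d′} → d + k ≡ d′ → d′ ∸ d ≡ k
    gap {d} {k} refl = m+n∸m≡n d k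

  start : ∀ b → Chasing (parity (level b)) 0 (root₁ , root₂) b
  start (b₁ , b₂) =
    chasing (R₁.depth b₁) (R₂.depth b₂) (R₁.root-Ancestor b₁) (R₂.root-Ancestor b₂)
      (λ d → ⊥-elim (n≮0 (subst (0 <_) R₁.depth-root d)))
      (λ d → ⊥-elim (n≮0 (subst (0 <_) R₂.depth-root d)))
      refl z≤n

  pursue-stays : ∀ {a b k₁ k₂} → parity (k₁ + k₂) ≡ 0ℙ → pursue a b k₁ k₂ ≡ a
  pursue-stays even rewrite even = refl

  pursue-descends₁ : ∀ {a₁ a₂ b₁ b₂ k₁ k₂} → parity (k₁ + k₂) ≡ 1ℙ → k₂ < k₁ →
                     pursue (a₁ , a₂) (b₁ , b₂) k₁ k₂ ≡ (R₁.ancestorAt (k₁ ∸ 1) b₁ , a₂)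
  pursue-descends₁ {k₁ = k₁} {k₂} odd k₂<k₁ rewrite odd with k₂ <? k₁
  ... | yes _    = refl
  ... | no k₂≮k₁ = ⊥-elim (k₂≮k₁ k₂<k₁)

  pursue-descends₂ : ∀ {a₁ a₂ b₁ b₂ k₁ k₂} → parity (k₁ + k₂) ≡ 1ℙ → ¬ k₂ < k₁ →
                     pursue (a₁ , a₂) (b₁ , b₂) k₁ k₂ ≡ (a₁ , R₂.ancestorAt (k₂ ∸ 1) b₂)
  pursue-descends₂ {k₁ = k₁} {k₂} odd k₂≮k₁ rewrite odd with k₂ <? k₁
  ... | yes k₂<k₁ = ⊥-elim (k₂≮k₁ k₂<k₁)
  ... | no _      = refl

  respond : ∀ {p m a b} → Chasing p m a b → ∃ λ a′ → chase a b ≡ a′ × Move _⇿_ a a′ × Chasing 0ℙ m a′ b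
  respond {0ℙ} {a = a} c@(chasing _ _ _ _ _ _ even _) =
    a , trans (chase-pursue c) (pursue-stays even) , inj₁ refl , c
  respond {1ℙ} {m} {a₁ , a₂} c@(chasing k₁ k₂ anc₁ anc₂ lead₁ lead₂ odd progress) with k₂ <? k₁
  ... | yes k₂<k₁@(s≤s {n = j} k₂≤j) with x , par , anc₁′ ← R₁.Ancestor-towards anc₁ =
    (x , a₂) ,
    trans (chase-pursue c) (trans (pursue-descends₁ odd k₂<k₁) (cong (_, a₂) (R₁.ancestorAt-Ancestor anc₁′))) ,
    inj₂ (inj₂ (refl , R₁.Parent⇒Adj par)) ,
    chasing j k₂ anc₁′ anc₂ (λ _ → k₂≤j) (≤-pred ∘ lead₂)
      (trans (OneApart-parity {suc (j + k₂)} decr) (cong _⁻¹ odd))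
      (subst (λ d → m ≤ d + R₂.depth a₂) (sym (R₁.Parent⇒depth par)) progress)
  ... | no k₂≮k₁ with ≤∧≢⇒< (≮⇒≥ k₂≮k₁) (odd⇒≢ odd)
  ...   | s≤s {n = j} k₁≤j with x , par , anc₂′ ← R₂.Ancestor-towards anc₂ =
    (a₁ , x) ,
    trans (chase-pursue c) (trans (pursue-descends₂ odd k₂≮k₁) (cong (a₁ ,_) (R₂.ancestorAt-Ancestor anc₂′))) ,
    inj₂ (inj₁ (refl , R₂.Parent⇒Adj par)) ,
    chasing k₁ j anc₁ anc₂′ (≤-pred ∘ lead₁) (λ _ → k₁≤j)
      (trans (OneApart-parity (OneApart-+ˡ k₁ decr)) (cong _⁻¹ odd))
      (subst (m ≤_) (trans (sym (+-suc _ _)) (cong (R₁.depth a₁ +_) (sym (R₂.Parent⇒depth par)))) progress)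

  robber-moves : ∀ {m a b b′} → Chasing 0ℙ m a b → a ≢ b → b ⇿ b′ → Chasing 1ℙ (suc m) a b′
  robber-moves (chasing k₁ k₂ anc₁ anc₂ lead₁ lead₂ even progress) a≢b (inj₁ (refl , e))
    with R₂.Ancestor-adjacent anc₂ e
  ... | inj₁ (k₂′ , anc₂′ , apart) =
    chasing k₁ k₂′ anc₁ anc₂′ (λ d → ≤-trans (OneApart-≤ apart) (s≤s (lead₁ d)))
      (λ d → ≤-trans (lead₂ d) (OneApart-≥ apart))
      (trans (OneApart-parity (OneApart-+ˡ k₁ apart)) (cong _⁻¹ even)) (s≤s progress)
  ... | inj₂ (refl , d) with refl ← n≤0⇒n≡0 (lead₂ d) =
    ⊥-elim (a≢b (cong₂ _,_ (R₁.Ancestor-zero anc₁) (R₂.Ancestor-zero anc₂)))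
  robber-moves (chasing k₁ k₂ anc₁ anc₂ lead₁ lead₂ even progress) a≢b (inj₂ (refl , e))
    with R₁.Ancestor-adjacent anc₁ e
  ... | inj₁ (k₁′ , anc₁′ , apart) =
    chasing k₁′ k₂ anc₁′ anc₂ (λ d → ≤-trans (lead₁ d) (OneApart-≥ apart))
      (λ d → ≤-trans (OneApart-≤ apart) (s≤s (lead₂ d)))
      (trans (OneApart-parity (OneApart-+ʳ k₂ apart)) (cong _⁻¹ even)) (s≤s progress)
  ... | inj₂ (refl , d) with refl ← n≤0⇒n≡0 (lead₁ d) =
    ⊥-elim (a≢b (cong₂ _,_ (R₁.Ancestor-zero anc₁) (R₂.Ancestor-zero anc₂)))

  capture : ∀ {m a b} → Chasing 0ℙ m a b → level b ≤ m → a ≡ b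
  capture {m} {a₁ , a₂} {b₁ , b₂} (chasing k₁ k₂ anc₁ anc₂ _ _ _ progress) bound =
    cong₂ _,_ (R₁.Ancestor-zero (subst (λ k → R₁.Ancestor k a₁ b₁) (m+n≡0⇒m≡0 k₁ gaps≡0) anc₁))
              (R₂.Ancestor-zero (subst (λ k → R₂.Ancestor k a₂ b₂) (m+n≡0⇒n≡0 k₁ gaps≡0) anc₂))
    where
    open ≤-Reasoning
    gaps≤0 : level (a₁ , a₂) + (k₁ + k₂) ≤ level (a₁ , a₂) + 0
    gaps≤0 = begin
      level (a₁ , a₂) + (k₁ + k₂)                  ≡⟨ interchange +-commutativeSemigroup (R₁.depth a₁) (R₂.depth a₂) k₁ k₂ ⟩
      (R₁.depth a₁ + k₁) + (R₂.depth a₂ + k₂)      ≡⟨ cong₂ _+_ (R₁.Ancestor-depth anc₁) (R₂.Ancestor-depth anc₂) ⟩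
      level (b₁ , b₂)                              ≤⟨ bound ⟩
      m                                            ≤⟨ progress ⟩
      level (a₁ , a₂)                              ≡⟨ +-identityʳ _ ⟨
      level (a₁ , a₂) + 0                          ∎
    gaps≡0 : k₁ + k₂ ≡ 0
    gaps≡0 = n≤0⇒n≡0 (+-cancelˡ-≤ (level (a₁ , a₂)) _ _ gaps≤0)

  cop : CopStrategy V
  cop = positional (root₁ , root₂) chase

  module Play (r : ℕ → V) (legal : RobberLegal _⇿_ r) where

    c : ℕ → V
    c = copPos cop r

    mutual
      invariant : ∀ {t m} → MovesCount r t m → Uncaptured c r t → ∃ λ p → Chasing p m (c t) (r t)
      invariant mc0 _ = _ , start (r 0)
      invariant (mcStay stayed mc) unc =
        0ℙ , subst (Chasing 0ℙ _ _) stayed (proj₂ (cop-responds mc (Uncaptured-pred unc)))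
      invariant (mcMove {t} moved mc) unc with legal t
      ... | inj₁ stayed = ⊥-elim (moved stayed)
      ... | inj₂ moved′ =
        1ℙ , robber-moves (proj₂ (cop-responds mc (Uncaptured-pred unc))) (proj₂ unc t (n<1+n t)) moved′

      cop-responds : ∀ {t m} → MovesCount r t m → Uncaptured c r t →
                     Move _⇿_ (c t) (c (suc t)) × Chasing 0ℙ m (c (suc t)) (r t)
      cop-responds {t} mc unc =
        let a′ , chased , move , chasing′ = respond (proj₂ (invariant mc unc))
            next≡ = trans (copPos-positional r t) chased
        in subst (Move _⇿_ (c t)) (sym next≡) move , subst (λ a → Chasing 0ℙ _ a (r t)) (sym next≡) chasing′

    cop-legal : ∀ t → Uncaptured c r t → Move _⇿_ (c t) (c (suc t))
    cop-legal t = proj₁ ∘ cop-responds (proj₂ (movesCount (≡-dec _≟_ _≟_) r t))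

    cop-captures : ∀ {ρ} → EccLe _⇿_ (root₁ , root₂) ρ →
                   ∀ t → MovesCount r t ρ → Uncaptured c r t → c (suc t) ≡ r t
    cop-captures ecc t mc unc = capture (proj₂ (cop-responds mc unc)) (level-bound ecc (r t))

lemma2p1 : (T₁ T₂ : Graph) → IsTree T₁ → IsTree T₂ →
    (ρ : ℕ) → IsRadius (ProdAdj T₁ T₂) ρ →
    Σ (CopStrategy (ProdV T₁ T₂)) λ σ →
      (r : ℕ → ProdV T₁ T₂) → RobberLegal (ProdAdj T₁ T₂) r →
        ((t : ℕ) → Uncaptured (copPos σ r) r t →
           Move (ProdAdj T₁ T₂) (copPos σ r t) (copPos σ r (suc t)))
        × ((t : ℕ) → MovesCount r t ρ → Uncaptured (copPos σ r) r t →
           copPos σ r (suc t) ≡ r t)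
lemma2p1 T₁ T₂ (_ , connected₁ , acyclic₁) (_ , connected₂ , acyclic₂) ρ (((root₁ , root₂) , ecc) , _) =
  cop , λ r legal → let open Play r legal in cop-legal , cop-captures ecc
  where open Pursuit T₁ T₂ connected₁ acyclic₁ root₁ connected₂ acyclic₂ root₂
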